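{- Let $G=(V,E)$ be a graph, $B$ a set of terminal pairs with terminal set $T=T(B)$, and let $M\subseteq V\setminus T$ be a node multicut of $(G,B)$. Then $M$ is a minimal node multicut if and only if there are connected components $C_1,\dots,C_\ell$ of $G-M$, each containing at least one terminal of $T$, such that (1) no component contains both vertices of a terminal pair of $B$, and (2) for every $v\in M$ there is a terminal pair $\{s,t\}\in B$ such that the component (among $C_1,\dots,C_\ell$) containing $s$ and the component containing $t$ both contain a neighbor of $v$.
   Context: Graphs are finite, undirected, connected, simple. $B$ is a set of unordered pairs of vertices; $T(B)$ is the set of vertices occurring in them. A node multicut of $(G,B)$ is a set $M\subseteq V\setminus T(B)$ such that $G-M$ contains no path between $s$ and $t$ for any $\{s,t\}\in B$; it is minimal if no proper subset is a node multicut. -}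

module Defs where

open import Data.Nat using (ℕ)
open import Data.Fin using (Fin)
open import Data.Fin.Subset using (Subset; _∈_; _∉_; _⊂_; ⊥)
open import Data.Bool using (Bool; T)
open import Data.Product using (_×_; Σ; ∃; ∃-syntax; _,_)
open import Data.Sum using (_⊎_)
open import Data.List using (List)
open import Data.List.Membership.Propositional using () renaming (_∈_ to _∈ₗ_)
open import Relation.Nullary using (¬_)
open import Relation.Binary.PropositionalEquality using (_≡_)

record Graph (n : ℕ) : Set where
  field
    adj       : Fin n → Fin n → Bool
    symmetric : ∀ u v → adj u v ≡ adj v u
    irrefl    : ∀ u → adj u u ≡ Data.Bool.false

  Adj : Fin n → Fin n → Set
  Adj u v = T (adj u v)

open Graph public

data Reach {n : ℕ} (G : Graph n) (M : Subset n) : Fin n → Fin n → Set where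
  here : ∀ {u} → u ∉ M → Reach G M u u
  step : ∀ {u w v} → u ∉ M → Adj G u w → Reach G M w v → Reach G M u v

Connected : {n : ℕ} → Graph n → Set
Connected {n} G = ∀ (u v : Fin n) → Reach G ⊥ u v

Pairs : ℕ → Set
Pairs n = List (Fin n × Fin n)

IsTerminal : {n : ℕ} → Pairs n → Fin n → Set
IsTerminal B x = ∃[ p ] (p ∈ₗ B × (Data.Product.proj₁ p ≡ x ⊎ Data.Product.proj₂ p ≡ x))

IsMulticut : {n : ℕ} → Graph n → Pairs n → Subset n → Set
IsMulticut {n} G B M =
  (∀ (x : Fin n) → x ∈ M → ¬ IsTerminal B x) ×
  (∀ (s t : Fin n) → (s , t) ∈ₗ B → ¬ Reach G M s t)

IsMinimalMulticut : {n : ℕ} → Graph n → Pairs n → Subset n → Set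
IsMinimalMulticut G B M =
  IsMulticut G B M × (∀ M′ → M′ ⊂ M → ¬ IsMulticut G B M′)

IsComponent : {n : ℕ} → Graph n → Subset n → Subset n → Set
IsComponent {n} G M C =
  (∃[ x ] x ∈ C) ×
  (∀ (x : Fin n) → x ∈ C → x ∉ M) ×
  (∀ (x y : Fin n) → x ∈ C → y ∈ C → Reach G M x y) ×
  (∀ (x y : Fin n) → x ∈ C → Reach G M x y → y ∈ C)

HasNeighbourIn : {n : ℕ} → Graph n → Fin n → Subset n → Set
HasNeighbourIn G v C = ∃[ u ] (Adj G v u × u ∈ C)

GoodComponents : {n : ℕ} → Graph n → Pairs n → Subset n → Set
GoodComponents {n} G B M =
  Σ ℕ λ ℓ → Σ (Fin ℓ → Subset n) λ C →
    (∀ i → IsComponent G M (C i)) ×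
    (∀ i → ∃[ x ] (x ∈ C i × IsTerminal B x)) ×
    (∀ i (s t : Fin n) → (s , t) ∈ₗ B → ¬ (s ∈ C i × t ∈ C i)) ×
    (∀ (v : Fin n) → v ∈ M →
       ∃[ s ] ∃[ t ] ((s , t) ∈ₗ B ×
         ∃[ i ] ∃[ j ] (s ∈ C i × t ∈ C j ×
                         HasNeighbourIn G v (C i) × HasNeighbourIn G v (C j))))

module Submission where

-- Let M be a node multicut of (G, B).  For a vertex x outside M, the set of
-- vertices reachable from x in G − M is a connected component of G − M.  As
-- C₁,…,C_ℓ we take these components, one for each terminal occurrence in B.
--
-- (⇒) Condition (1) is just the multicut property.  For (2) let v ∈ M.  By
-- minimality M − v is not a multicut, so some pair {s,t} ∈ B is joined by a
-- path in G − (M − v).  This path must visit v, and its part before the first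
-- visit lies in G − M; so s, and symmetrically t, reaches a neighbour of v in
-- G − M.  Constructively, extracting the pair {s,t} needs reachability in
-- G − M to be decidable, which is proved first (a search that deletes every
-- vertex it has left).
--
-- (⇐) If M′ ⊂ M misses v ∈ M, the pair {s,t} of condition (2) is joined in
-- G − M′ by walking inside the component of s to a neighbour of v, crossing
-- v, and walking inside the component of t; hence M′ is not a multicut.

open import Defs
open import Data.Nat using (ℕ; zero; suc; _+_; _≤_; _<_)
open import Data.Nat.Properties using (≤-trans; ≤-reflexive; <-≤-trans; <-irrefl; +-suc; +-monoʳ-≤; m≤m+n)
open import Data.Fin using (Fin)
open import Data.Fin.Properties using (any?) renaming (_≟_ to _≟ᶠ_)
open import Data.Fin.Subset using (Subset; _∈_; _∉_; _⊂_; _⊆_; _∪_; _-_; ⁅_⁆; ∣_∣)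
open import Data.Fin.Subset.Properties using (_∈?_; p⊂q⇒∣p∣<∣q∣; ∣p∣≤n; p⊆p∪q; x∈p∪q⁺; x∈p∪q⁻; x∈⁅x⁆; x≢y⇒x∉⁅y⁆; p─q⊆p; x∈p∧x≢y⇒x∈p-y; x∈p⇒p-x⊂p)
open import Data.Vec using (tabulate)
open import Data.Vec.Properties using (lookup∘tabulate; []=⇒lookup; lookup⇒[]=)
open import Data.Bool using (T; T?)
open import Data.Product using (_×_; ∃-syntax; _,_; proj₁; proj₂)
open import Data.Sum using (_⊎_; inj₁; inj₂; [_,_]′)
open import Data.List using (List; []; _∷_; length; lookup)
open import Data.List.Membership.Propositional using (find; lose) renaming (_∈_ to _∈ₗ_)
open import Data.List.Membership.Propositional.Properties using (∈-lookup)
open import Data.List.Relation.Unary.Any using (here; there; index) renaming (any? to anyₗ?)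
open import Data.List.Relation.Unary.Any.Properties using (lookup-index)
open import Data.Empty using (⊥-elim)
open import Relation.Nullary using (¬_; Dec; yes; no; does; _×-dec_)
open import Relation.Nullary.Decidable using (dec-true)
open import Relation.Binary.PropositionalEquality using (_≡_; _≢_; refl; sym; trans; subst)
open import Function.Bundles using (_⇔_; mk⇔)

∉-∪⁅⁆ : ∀ {n} {M : Subset n} {x u : Fin n} → x ∉ M → x ≢ u → x ∉ M ∪ ⁅ u ⁆
∉-∪⁅⁆ {M = M} {u = u} x∉M x≢u x∈ = [ x∉M , x≢y⇒x∉⁅y⁆ x≢u ]′ (x∈p∪q⁻ M ⁅ u ⁆ x∈)

∣M∣<∣M∪⁅u⁆∣ : ∀ {n} {M : Subset n} {u : Fin n} → u ∉ M → ∣ M ∣ < ∣ M ∪ ⁅ u ⁆ ∣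
∣M∣<∣M∪⁅u⁆∣ {u = u} u∉M = p⊂q⇒∣p∣<∣q∣ (p⊆p∪q ⁅ u ⁆ , u , x∈p∪q⁺ (inj₂ (x∈⁅x⁆ u)) , u∉M)

select : ∀ {n} {P : Fin n → Set} → (∀ x → Dec (P x)) → Subset n
select P? = tabulate (λ x → does (P? x))

select⁺ : ∀ {n} {P : Fin n → Set} (P? : ∀ x → Dec (P x)) {x : Fin n} → P x → x ∈ select P?
select⁺ P? {x} px = lookup⇒[]= x _ (trans (lookup∘tabulate _ x) (dec-true (P? x) px))

select⁻ : ∀ {n} {P : Fin n → Set} (P? : ∀ x → Dec (P x)) {x : Fin n} → x ∈ select P? → P x
select⁻ P? {x} x∈ with P? x | trans (sym (lookup∘tabulate (λ y → does (P? y)) x)) ([]=⇒lookup x∈)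
... | yes px | _ = px
... | no _   | ()

module _ {n : ℕ} (G : Graph n) where

  adj-sym : ∀ {u v} → Adj G u v → Adj G v u
  adj-sym {u} {v} = subst T (symmetric G u v)

  reach-start∉ : ∀ {M u v} → Reach G M u v → u ∉ M
  reach-start∉ (here u∉M)     = u∉M
  reach-start∉ (step u∉M _ _) = u∉M

  reach-end∉ : ∀ {M u v} → Reach G M u v → v ∉ M
  reach-end∉ (here v∉M)   = v∉M
  reach-end∉ (step _ _ p) = reach-end∉ p

  reach-trans : ∀ {M u v w} → Reach G M u v → Reach G M v w → Reach G M u w
  reach-trans (here _)         q = q
  reach-trans (step u∉M u~x p) q = step u∉M u~x (reach-trans p q)

  reach-snoc : ∀ {M u v w} → Reach G M u v → Adj G v w → w ∉ M → Reach G M u w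
  reach-snoc p v~w w∉M = reach-trans p (step (reach-end∉ p) v~w (here w∉M))

  reach-sym : ∀ {M u v} → Reach G M u v → Reach G M v u
  reach-sym (here u∉M)       = here u∉M
  reach-sym (step u∉M u~x p) = reach-snoc (reach-sym p) (adj-sym u~x) u∉M

  reach-weaken : ∀ {M M′ u v} → M ⊆ M′ → Reach G M′ u v → Reach G M u v
  reach-weaken M⊆M′ (here u∉M′)        = here (λ u∈M → u∉M′ (M⊆M′ u∈M))
  reach-weaken M⊆M′ (step u∉M′ u~x p) = step (λ u∈M → u∉M′ (M⊆M′ u∈M)) u~x (reach-weaken M⊆M′ p)

  lastVisit : ∀ {M x v} (u : Fin n) → Reach G M x v →
              Reach G (M ∪ ⁅ u ⁆) x v ⊎ u ≡ v ⊎ ∃[ w ] (Adj G u w × Reach G (M ∪ ⁅ u ⁆) w v)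
  lastVisit {x = x} u (here x∉M) with x ≟ᶠ u
  ... | yes refl = inj₂ (inj₁ refl)
  ... | no x≢u   = inj₁ (here (∉-∪⁅⁆ x∉M x≢u))
  lastVisit {x = x} u (step {w = w} x∉M x~w p) with lastVisit u p | x ≟ᶠ u
  ... | inj₁ q | yes refl = inj₂ (inj₂ (w , x~w , q))
  ... | inj₁ q | no x≢u   = inj₁ (step (∉-∪⁅⁆ x∉M x≢u) x~w q)
  ... | inj₂ r | _        = inj₂ r

  -- Reachability in G − M is decidable: from u either stop at v, or step to a
  -- neighbour w and search on in G − (M ∪ {u}).  The fuel k bounds how often
  -- M can still grow before it would exceed all n vertices.
  reach?′ : (k : ℕ) (M : Subset n) → n ≤ k + ∣ M ∣ → ∀ u v → Dec (Reach G M u v)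
  reach?′ k M bound u v with u ∈? M
  ... | yes u∈M = no (λ p → reach-start∉ p u∈M)
  ... | no u∉M  = search k bound
    where
    M⁺ = M ∪ ⁅ u ⁆

    grows : ∣ M ∣ < ∣ M⁺ ∣
    grows = ∣M∣<∣M∪⁅u⁆∣ u∉M

    noPath : ¬ Reach G M⁺ u v → u ≢ v → ¬ (∃[ w ] (Adj G u w × Reach G M⁺ w v)) → ¬ Reach G M u v
    noPath ¬avoid u≢v ¬exit p = [ ¬avoid , [ u≢v , ¬exit ]′ ]′ (lastVisit u p)

    search : (k : ℕ) → n ≤ k + ∣ M ∣ → Dec (Reach G M u v)
    search zero bound = ⊥-elim (<-irrefl refl (<-≤-trans grows (≤-trans (∣p∣≤n M⁺) bound)))
    search (suc k) bound with u ≟ᶠ v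
    ... | yes refl = yes (here u∉M)
    ... | no u≢v with any? (λ w → T? (adj G u w) ×-dec reach?′ k M⁺ bound′ w v)
      where
      bound′ : n ≤ k + ∣ M⁺ ∣
      bound′ = ≤-trans bound (≤-trans (≤-reflexive (sym (+-suc k ∣ M ∣))) (+-monoʳ-≤ k grows))
    ... | yes (w , u~w , q) = yes (step u∉M u~w (reach-weaken (p⊆p∪q ⁅ u ⁆) q))
    ... | no ¬exit = no (noPath (λ q → reach-start∉ q (x∈p∪q⁺ (inj₂ (x∈⁅x⁆ u)))) u≢v ¬exit)

  reach? : ∀ M u v → Dec (Reach G M u v)
  reach? M = reach?′ n M (m≤m+n n ∣ M ∣)

  reachableFrom : Subset n → Fin n → Subset n
  reachableFrom M x = select (reach? M x)

  reachableFrom-component : ∀ {M x} → x ∉ M → IsComponent G M (reachableFrom M x)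
  reachableFrom-component {M} {x} x∉M =
      (x , select⁺ (reach? M x) (here x∉M))
    , (λ y y∈ → reach-end∉ (select⁻ (reach? M x) y∈))
    , (λ y z y∈ z∈ → reach-trans (reach-sym (select⁻ (reach? M x) y∈)) (select⁻ (reach? M x) z∈))
    , (λ y z y∈ y⇝z → select⁺ (reach? M x) (reach-trans (select⁻ (reach? M x) y∈) y⇝z))

  firstVisit : ∀ {M v x y} → x ∉ M → Reach G (M - v) x y →
               Reach G M x y ⊎ ∃[ a ] (Reach G M x a × Adj G a v)
  firstVisit x∉M (here _) = inj₁ (here x∉M)
  firstVisit {v = v} x∉M (step {w = w} _ x~w p) with w ≟ᶠ v
  ... | yes refl = inj₂ (_ , here x∉M , x~w)
  ... | no w≢v with firstVisit (λ w∈M → reach-start∉ p (x∈p∧x≢y⇒x∈p-y w∈M w≢v)) p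
  ...   | inj₁ q             = inj₁ (step x∉M x~w q)
  ...   | inj₂ (a , q , a~v) = inj₂ (a , step x∉M x~w q , a~v)

  bothSidesTouch : ∀ {M v s t} → s ∉ M → t ∉ M → ¬ Reach G M s t → Reach G (M - v) s t →
                   (∃[ a ] (Reach G M s a × Adj G a v)) × (∃[ b ] (Reach G M t b × Adj G b v))
  bothSidesTouch s∉M t∉M separated p with firstVisit s∉M p | firstVisit t∉M (reach-sym p)
  ... | inj₁ q  | _       = ⊥-elim (separated q)
  ... | _       | inj₁ q  = ⊥-elim (separated (reach-sym q))
  ... | inj₂ sa | inj₂ tb = sa , tb

  detour : ∀ {M M′ C C′ v s t} → M′ ⊆ M → v ∉ M′ → IsComponent G M C → IsComponent G M C′ →
           s ∈ C → t ∈ C′ → HasNeighbourIn G v C → HasNeighbourIn G v C′ → Reach G M′ s t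
  detour M′⊆M v∉M′ (_ , _ , connC , _) (_ , _ , connC′ , _) s∈C t∈C′ (a , v~a , a∈C) (b , v~b , b∈C′) =
    reach-trans (reach-snoc (reach-weaken M′⊆M (connC _ _ s∈C a∈C)) (adj-sym v~a) v∉M′)
                (step v∉M′ v~b (reach-weaken M′⊆M (connC′ _ _ b∈C′ t∈C′)))

  -- A set avoiding the terminals that is not a multicut joins some pair of B;
  -- decidability of reachability turns this negation into a witness.
  joinedPair : ∀ (B : Pairs n) M′ → (∀ x → x ∈ M′ → ¬ IsTerminal B x) → ¬ IsMulticut G B M′ →
               ∃[ s ] ∃[ t ] ((s , t) ∈ₗ B × Reach G M′ s t)
  joinedPair B M′ avoids notCut with anyₗ? (λ p → reach? M′ (proj₁ p) (proj₂ p)) B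
  ... | yes joined with find joined
  ...   | (s , t) , st∈B , s⇝t = s , t , st∈B , s⇝t
  joinedPair B M′ avoids notCut | no none =
    ⊥-elim (notCut (avoids , λ s t st∈B s⇝t → none (lose st∈B s⇝t)))

terminals : ∀ {n} → Pairs n → List (Fin n)
terminals []            = []
terminals ((s , t) ∷ B) = s ∷ t ∷ terminals B

terminals-complete : ∀ {n} (B : Pairs n) {s t} → (s , t) ∈ₗ B → s ∈ₗ terminals B × t ∈ₗ terminals B
terminals-complete (_ ∷ B) (here refl) = here refl , there (here refl)
terminals-complete (_ ∷ B) (there st∈B) with terminals-complete B st∈B
... | s∈ , t∈ = there (there s∈) , there (there t∈)

terminals-sound : ∀ {n} (B : Pairs n) {x} → x ∈ₗ terminals B → IsTerminal B x
terminals-sound ((s , t) ∷ B) (here refl)          = (s , t) , here refl , inj₁ refl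
terminals-sound ((s , t) ∷ B) (there (here refl))  = (s , t) , here refl , inj₂ refl
terminals-sound (_ ∷ B)       (there (there x∈))   with terminals-sound B x∈
... | p , p∈B , x∈p = p , there p∈B , x∈p

goodComponents⇒minimal : ∀ {n} (G : Graph n) (B : Pairs n) (M : Subset n) →
                         IsMulticut G B M → GoodComponents G B M → IsMinimalMulticut G B M
goodComponents⇒minimal G B M cut (_ , C , isComp , _ , _ , indispensable) = cut , noSmallerCut
  where
  noSmallerCut : ∀ M′ → M′ ⊂ M → ¬ IsMulticut G B M′
  noSmallerCut M′ (M′⊆M , v , v∈M , v∉M′) (_ , separates) with indispensable v v∈M
  ... | s , t , st∈B , i , j , s∈Cᵢ , t∈Cⱼ , v-Cᵢ , v-Cⱼ =
    separates s t st∈B (detour G M′⊆M v∉M′ (isComp i) (isComp j) s∈Cᵢ t∈Cⱼ v-Cᵢ v-Cⱼ)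

minimal⇒goodComponents : ∀ {n} (G : Graph n) (B : Pairs n) (M : Subset n) →
                         IsMinimalMulticut G B M → GoodComponents G B M
minimal⇒goodComponents {n} G B M ((avoids , separates) , minimal) =
  length Ts , C , (λ i → reachableFrom-component G (terminal∉M (∈-Ts i)))
  , (λ i → lookup Ts i , C∋ i (here (terminal∉M (∈-Ts i))) , terminals-sound B (∈-Ts i))
  , (λ i s t st∈B (s∈ , t∈) → separates s t st∈B (reach-trans G (reach-sym G (⇝C i s∈)) (⇝C i t∈)))
  , indispensable
  where
  Ts = terminals B

  C : Fin (length Ts) → Subset n
  C i = reachableFrom G M (lookup Ts i)

  ∈-Ts : ∀ i → lookup Ts i ∈ₗ Ts
  ∈-Ts = ∈-lookup

  terminal∉M : ∀ {x} → x ∈ₗ Ts → x ∉ M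
  terminal∉M x∈Ts x∈M = avoids _ x∈M (terminals-sound B x∈Ts)

  ⇝C : ∀ i {y} → y ∈ C i → Reach G M (lookup Ts i) y
  ⇝C i = select⁻ (reach? G M (lookup Ts i))

  C∋ : ∀ i {y} → Reach G M (lookup Ts i) y → y ∈ C i
  C∋ i = select⁺ (reach? G M (lookup Ts i))

  ∈C : ∀ {x y} (x∈Ts : x ∈ₗ Ts) → Reach G M x y → y ∈ C (index x∈Ts)
  ∈C x∈Ts x⇝y = C∋ (index x∈Ts) (subst (λ z → Reach G M z _) (lookup-index x∈Ts) x⇝y)

  indispensable : ∀ v → v ∈ M →
    ∃[ s ] ∃[ t ] ((s , t) ∈ₗ B × ∃[ i ] ∃[ j ] (s ∈ C i × t ∈ C j ×
                   HasNeighbourIn G v (C i) × HasNeighbourIn G v (C j)))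
  indispensable v v∈M
    with joinedPair G B (M - v) (λ x x∈ → avoids x (p─q⊆p M ⁅ v ⁆ x∈)) (minimal (M - v) (x∈p⇒p-x⊂p v∈M))
  ... | s , t , st∈B , s⇝t with terminals-complete B st∈B
  ...   | s∈Ts , t∈Ts with bothSidesTouch G (terminal∉M s∈Ts) (terminal∉M t∈Ts) (separates s t st∈B) s⇝t
  ...     | (a , s⇝a , a~v) , (b , t⇝b , b~v) =
    s , t , st∈B , index s∈Ts , index t∈Ts
    , ∈C s∈Ts (here (terminal∉M s∈Ts)) , ∈C t∈Ts (here (terminal∉M t∈Ts))
    , (a , adj-sym G a~v , ∈C s∈Ts s⇝a) , (b , adj-sym G b~v , ∈C t∈Ts t⇝b)

lemma1 : ∀ {n : ℕ} (G : Graph n) → Connected G → (B : Pairs n) → (M : Subset n) →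
           IsMulticut G B M → (IsMinimalMulticut G B M ⇔ GoodComponents G B M)
lemma1 G _ B M cut = mk⇔ (minimal⇒goodComponents G B M) (goodComponents⇒minimal G B M cut)
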